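{- The group $\mathcal{G}(\mathcal{L}_4)$ is a subgroup of the isometry group $\mathcal{G}(Q)\cong \operatorname{O}^+(8,2)$ of the hyperbolic quadric defined by $Q$; i.e. $Q(gx)=Q(x)$ for all $g\in\mathcal{G}(\mathcal{L}_4)$ and $x\in V_8$.
   Context: Work over $\mathbb{F}_2$. Let $V_8=V(8,2)$ with basis $e_1,\dots,e_8$, and $V_a=\langle e_1,e_8\rangle$, $V_b=\langle e_2,e_7\rangle$, $V_c=\langle e_3,e_6\rangle$, $V_d=\langle e_4,e_5\rangle$. $\mathcal{G}(\mathcal{L}_4)\le\operatorname{GL}(8,2)$ is the stabilizer of the set $\{V_a,V_b,V_c,V_d\}$ (equivalently of the tetrad of lines $\mathcal{L}_4=\{\mathbb{P}V_a,\mathbb{P}V_b,\mathbb{P}V_c,\mathbb{P}V_d\}$ in $\operatorname{PG}(7,2)$); it equals $(\operatorname{GL}(V_a)\times\operatorname{GL}(V_b)\times\operatorname{GL}(V_c)\times\operatorname{GL}(V_d))\rtimes\operatorname{Sym}(4)$. $Q(x)=x_1x_8+x_2x_7+x_3x_6+x_4x_5+\sum_{i=1}^8x_i$ for $x=\sum x_ie_i$; its zero set in $\operatorname{PG}(7,2)$ is a hyperbolic quadric $\mathcal{H}_7$. -}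

module Defs where

import Data.Nat as ℕ
open import Data.Bool using (Bool; true; false; _xor_; _∧_)
open import Data.Fin using (Fin; zero; suc)
open import Data.Product using (Σ; _×_; _,_; ∃)
open import Relation.Binary.PropositionalEquality using (_≡_; _≢_)

-- The field F₂ is modelled by Bool: addition = xor, multiplication = ∧.
F₂ : Set
F₂ = Bool

-- V₈ = F₂⁸ as coordinate functions; coordinate k : Fin 8 is x_{k+1}
-- (so e₁ ↦ index 0, …, e₈ ↦ index 7).
V₈ : Set
V₈ = Fin 8 → F₂

_≈ᵛ_ : V₈ → V₈ → Set
x ≈ᵛ y = ∀ k → x k ≡ y k

Σ₂ : ∀ {n} → (Fin n → F₂) → F₂
Σ₂ {ℕ.zero} f = false
Σ₂ {ℕ.suc n} f = f zero xor Σ₂ (λ k → f (suc k))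

Mat₈ : Set
Mat₈ = Fin 8 → Fin 8 → F₂

_·_ : Mat₈ → V₈ → V₈
(g · x) i = Σ₂ (λ k → g i k ∧ x k)

IsGL : Mat₈ → Set
IsGL g = Σ Mat₈ λ h → (∀ x → (h · (g · x)) ≈ᵛ x) × (∀ x → (g · (h · x)) ≈ᵛ x)

-- The four 2-spaces V_a = ⟨e₁,e₈⟩, V_b = ⟨e₂,e₇⟩, V_c = ⟨e₃,e₆⟩, V_d = ⟨e₄,e₅⟩,
-- indexed by Fin 4 (0 ↦ a, 1 ↦ b, 2 ↦ c, 3 ↦ d): block i is ⟨e_{i+1}, e_{8-i}⟩.
blockFst blockSnd : Fin 4 → Fin 8
blockFst zero = zero
blockFst (suc zero) = suc zero
blockFst (suc (suc zero)) = suc (suc zero)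
blockFst (suc (suc (suc zero))) = suc (suc (suc zero))
blockSnd zero = suc (suc (suc (suc (suc (suc (suc zero))))))
blockSnd (suc zero) = suc (suc (suc (suc (suc (suc zero)))))
blockSnd (suc (suc zero)) = suc (suc (suc (suc (suc zero))))
blockSnd (suc (suc (suc zero))) = suc (suc (suc (suc zero)))

_∈V_ : V₈ → Fin 4 → Set
x ∈V i = ∀ k → k ≢ blockFst i → k ≢ blockSnd i → x k ≡ false

MapsOnto : Mat₈ → Fin 4 → Fin 4 → Set
MapsOnto g i j = (∀ x → x ∈V i → (g · x) ∈V j)
               × (∀ y → y ∈V j → Σ V₈ λ x → (x ∈V i) × ((g · x) ≈ᵛ y))

StabilizesTetrad : Mat₈ → Set
StabilizesTetrad g = (∀ i → ∃ λ j → MapsOnto g i j) × (∀ j → ∃ λ i → MapsOnto g i j)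

In𝒢L₄ : Mat₈ → Set
In𝒢L₄ g = IsGL g × StabilizesTetrad g

-- Q(x) = x₁x₈ + x₂x₇ + x₃x₆ + x₄x₅ + Σ xᵢ
Q : V₈ → F₂
Q x = (x (blockFst zero) ∧ x (blockSnd zero))
  xor (x (blockFst (suc zero)) ∧ x (blockSnd (suc zero)))
  xor (x (blockFst (suc (suc zero))) ∧ x (blockSnd (suc (suc zero))))
  xor (x (blockFst (suc (suc (suc zero)))) ∧ x (blockSnd (suc (suc (suc zero)))))
  xor Σ₂ x

-- Over F₂ one has ab + a + b = a ∨ b, so Q(x) is the parity of the number of
-- blocks V_a, …, V_d on which x has a nonzero component. An invertible g that
-- permutes the blocks (by σ, say) maps the component of x in V_i to the
-- component of gx in V_{σ i}, so it preserves which components are nonzero up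
-- to relabelling by σ, hence preserves their number and Q.

module Submission where

open import Defs
open import Algebra.Bundles using (CommutativeRing)
open import Data.Bool using (true; false; _xor_; _∧_; _∨_)
open import Data.Bool.Properties
  using (xor-∧-commutativeRing; xor-identityʳ; ∧-identityʳ; ∧-zeroʳ; ∨-conicalˡ; ∨-conicalʳ)
open import Data.Empty using (⊥-elim)
open import Data.Fin using (Fin; zero; suc; _≟_)
open import Data.Fin.Patterns using (0F; 1F; 2F; 3F; 4F; 5F; 6F; 7F)
open import Data.Fin.Properties using (suc-injective)
open import Data.Fin.Permutation using (Permutation′; permutation; _⟨$⟩ʳ_)
open import Data.Maybe using (just; nothing)
open import Data.Nat using (ℕ)
open import Data.Product using (_,_; proj₁; proj₂)
open import Data.Sum using (_⊎_; inj₁; inj₂; [_,_])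
open import Function using (_∘_; _⇔_; mk⇔; Equivalence)
open import Function.Definitions using (Injective)
import Function.Properties.Equivalence as ⇔
open import Relation.Binary.PropositionalEquality
  using (_≡_; _≢_; refl; sym; trans; cong; cong₂; subst; module ≡-Reasoning)
open import Relation.Nullary using (¬_; does; yes; no)
open import Relation.Nullary.Decidable using (dec-true; dec-false)
open import Tactic.RingSolver using (solve-∀)
open import Tactic.RingSolver.Core.AlmostCommutativeRing using (AlmostCommutativeRing; fromCommutativeRing)

open CommutativeRing xor-∧-commutativeRing using (+-commutativeMonoid)
open import Algebra.Properties.CommutativeMonoid.Sum +-commutativeMonoid using (sum; sum-cong-≗; sum-permute)

Σ₂≡sum : ∀ {n} (f : Fin n → F₂) → Σ₂ f ≡ sum f
Σ₂≡sum {ℕ.zero}  f = refl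
Σ₂≡sum {ℕ.suc n} f = cong (f zero xor_) (Σ₂≡sum (f ∘ suc))

Σ₂-cong : ∀ {n} {f f′ : Fin n → F₂} → (∀ k → f k ≡ f′ k) → Σ₂ f ≡ Σ₂ f′
Σ₂-cong {f = f} {f′} f≗f′ = trans (Σ₂≡sum f) (trans (sum-cong-≗ f≗f′) (sym (Σ₂≡sum f′)))

Σ₂-permute : ∀ {n} (f : Fin n → F₂) (π : Permutation′ n) → Σ₂ f ≡ Σ₂ (f ∘ (π ⟨$⟩ʳ_))
Σ₂-permute f π = trans (Σ₂≡sum f) (trans (sum-permute f π) (sym (Σ₂≡sum (f ∘ (π ⟨$⟩ʳ_)))))

Σ₂-zero : ∀ {n} {f : Fin n → F₂} → (∀ k → f k ≡ false) → Σ₂ f ≡ false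
Σ₂-zero {ℕ.zero}  f≡0 = refl
Σ₂-zero {ℕ.suc n} f≡0 rewrite f≡0 zero = Σ₂-zero (f≡0 ∘ suc)

Σ₂-single : ∀ {n} {f : Fin n → F₂} k → (∀ m → m ≢ k → f m ≡ false) → Σ₂ f ≡ f k
Σ₂-single {f = f} zero    f≡0 = trans (cong (f zero xor_) (Σ₂-zero (λ m → f≡0 (suc m) λ ()))) (xor-identityʳ _)
Σ₂-single         (suc k) f≡0 rewrite f≡0 zero (λ ()) = Σ₂-single k (λ m m≢k → f≡0 (suc m) (m≢k ∘ suc-injective))

blockOf : Fin 8 → Fin 4
blockOf 0F   = 0F
blockOf 1F   = 1F
blockOf 2F   = 2F
blockOf 3F   = 3F
blockOf 4F   = 3F
blockOf 5F   = 2F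
blockOf 6F   = 1F
blockOf 7F   = 0F

blockOf-blockFst : ∀ j → blockOf (blockFst j) ≡ j
blockOf-blockFst 0F   = refl
blockOf-blockFst 1F   = refl
blockOf-blockFst 2F   = refl
blockOf-blockFst 3F   = refl

blockOf-blockSnd : ∀ j → blockOf (blockSnd j) ≡ j
blockOf-blockSnd 0F   = refl
blockOf-blockSnd 1F   = refl
blockOf-blockSnd 2F   = refl
blockOf-blockSnd 3F   = refl

blockFst-or-blockSnd : ∀ k → k ≡ blockFst (blockOf k) ⊎ k ≡ blockSnd (blockOf k)
blockFst-or-blockSnd 0F   = inj₁ refl
blockFst-or-blockSnd 1F   = inj₁ refl
blockFst-or-blockSnd 2F   = inj₁ refl
blockFst-or-blockSnd 3F   = inj₁ refl
blockFst-or-blockSnd 4F   = inj₂ refl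
blockFst-or-blockSnd 5F   = inj₂ refl
blockFst-or-blockSnd 6F   = inj₂ refl
blockFst-or-blockSnd 7F   = inj₂ refl

∈V-outside : ∀ {x j k} → x ∈V j → blockOf k ≢ j → x k ≡ false
∈V-outside {j = j} x∈V k∉j = x∈V _
  (λ { refl → k∉j (blockOf-blockFst j) }) (λ { refl → k∉j (blockOf-blockSnd j) })

∈V-intro : ∀ {x j} → (∀ k → blockOf k ≢ j → x k ≡ false) → x ∈V j
∈V-intro x≡0 k k≢fst k≢snd = x≡0 k λ { refl → [ k≢fst , k≢snd ] (blockFst-or-blockSnd k) }

0v : V₈
0v _ = false

∈V-disjoint : ∀ {x i j} → i ≢ j → x ∈V i → x ∈V j → x ≈ᵛ 0v
∈V-disjoint {i = i} {j} i≢j x∈Vi x∈Vj k with blockOf k ≟ i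
... | no k∉i = ∈V-outside x∈Vi k∉i
... | yes refl = ∈V-outside x∈Vj i≢j

∈V-resp-≈ : ∀ {x y j} → x ≈ᵛ y → x ∈V j → y ∈V j
∈V-resp-≈ x≈y x∈V k k≢fst k≢snd = trans (sym (x≈y k)) (x∈V k k≢fst k≢snd)

blockNonzero : V₈ → Fin 4 → F₂
blockNonzero x j = x (blockFst j) ∨ x (blockSnd j)

blockNonzero≡false⇔ : ∀ {x j} → x ∈V j → (blockNonzero x j ≡ false ⇔ x ≈ᵛ 0v)
blockNonzero≡false⇔ {x} {j} x∈V = mk⇔ vanishes (λ x≈0 → cong₂ _∨_ (x≈0 _) (x≈0 _))
  where
  vanishes : blockNonzero x j ≡ false → x ≈ᵛ 0v
  vanishes nz≡0 k with k ≟ blockFst j | k ≟ blockSnd j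
  ... | yes refl | _        = ∨-conicalˡ _ _ nz≡0
  ... | no _     | yes refl = ∨-conicalʳ _ _ nz≡0
  ... | no k≢fst | no k≢snd = x∈V k k≢fst k≢snd

F₂-ring : AlmostCommutativeRing _ _
F₂-ring = fromCommutativeRing xor-∧-commutativeRing λ { false → just refl ; true → nothing }

∨≡∧-xor-xor : ∀ a b → a ∨ b ≡ (a ∧ b) xor (a xor b)
∨≡∧-xor-xor false b     = refl
∨≡∧-xor-xor true  false = refl
∨≡∧-xor-xor true  true  = refl

Q≡Σ₂-blockNonzero : ∀ x → Q x ≡ Σ₂ (blockNonzero x)
Q≡Σ₂-blockNonzero x =
  trans (Q-polynomial (x 0F) (x 1F) (x 2F) (x 3F) (x 4F) (x 5F) (x 6F) (x 7F))
        (sym (Σ₂-cong λ j → ∨≡∧-xor-xor (x (blockFst j)) (x (blockSnd j))))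
  where
  Q-polynomial : ∀ a b c d e f g h →
    (a ∧ h) xor (b ∧ g) xor (c ∧ f) xor (d ∧ e) xor (a xor (b xor (c xor (d xor (e xor (f xor (g xor (h xor false))))))))
    ≡ ((a ∧ h) xor (a xor h)) xor (((b ∧ g) xor (b xor g)) xor (((c ∧ f) xor (c xor f)) xor (((d ∧ e) xor (d xor e)) xor false)))
  Q-polynomial = solve-∀ F₂-ring

≡false-ext : ∀ {a b} → (a ≡ false ⇔ b ≡ false) → a ≡ b
≡false-ext {false} {false} _   = refl
≡false-ext {true}  {true}  _   = refl
≡false-ext {false} {true}  a⇔b with Equivalence.to a⇔b refl
... | ()
≡false-ext {true}  {false} a⇔b with Equivalence.from a⇔b refl
... | ()

restrict : V₈ → Fin 4 → V₈
restrict x j k = does (blockOf k ≟ j) ∧ x k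

restrict-∈V : ∀ x j → restrict x j ∈V j
restrict-∈V x j = ∈V-intro λ k k∉j → cong (_∧ x k) (dec-false (blockOf k ≟ j) k∉j)

blockNonzero-restrict : ∀ x j → blockNonzero (restrict x j) j ≡ blockNonzero x j
blockNonzero-restrict x 0F   = refl
blockNonzero-restrict x 1F   = refl
blockNonzero-restrict x 2F   = refl
blockNonzero-restrict x 3F   = refl

unit : Fin 8 → V₈
unit m k = does (k ≟ m)

unit-diag : ∀ m → unit m m ≡ true
unit-diag m = dec-true (m ≟ m) refl

unit-∈V : ∀ m → unit m ∈V blockOf m
unit-∈V m = ∈V-intro λ k k∉m → dec-false (k ≟ m) λ { refl → k∉m refl }

·-unit : ∀ g k m → (g · unit m) k ≡ g k m
·-unit g k m = trans (Σ₂-single m λ m′ m′≢m → trans (cong (g k m′ ∧_) (dec-false (m′ ≟ m) m′≢m)) (∧-zeroʳ _))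
                     (trans (cong (g k m ∧_) (unit-diag m)) (∧-identityʳ _))

·-cong : ∀ g {x y} → x ≈ᵛ y → (g · x) ≈ᵛ (g · y)
·-cong g x≈y k = Σ₂-cong λ m → cong (g k m ∧_) (x≈y m)

·-0v : ∀ g → (g · 0v) ≈ᵛ 0v
·-0v g k = Σ₂-zero λ m → ∧-zeroʳ (g k m)

unit≉0v : ∀ m → ¬ unit m ≈ᵛ 0v
unit≉0v m unit≈0 with trans (sym (unit-diag m)) (unit≈0 m)
... | ()

unit-blockFst-∈V : ∀ j → unit (blockFst j) ∈V j
unit-blockFst-∈V j = subst (unit (blockFst j) ∈V_) (blockOf-blockFst j) (unit-∈V (blockFst j))

IsGL⇒injective : ∀ g → IsGL g → Injective _≈ᵛ_ _≈ᵛ_ (g ·_)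
IsGL⇒injective g (h , h·g≈id , _) {x} {y} gx≈gy k = begin
  x k               ≡⟨ sym (h·g≈id x k) ⟩
  (h · (g · x)) k   ≡⟨ ·-cong h gx≈gy k ⟩
  (h · (g · y)) k   ≡⟨ h·g≈id y k ⟩
  y k               ∎
  where open ≡-Reasoning

module _ (g : Mat₈) (g-injective : Injective _≈ᵛ_ _≈ᵛ_ (g ·_)) where

  ·-≈0v⇔ : ∀ {x} → (g · x) ≈ᵛ 0v ⇔ x ≈ᵛ 0v
  ·-≈0v⇔ = mk⇔ (λ gx≈0 → g-injective λ k → trans (gx≈0 k) (sym (·-0v g k)))
               (λ x≈0 k → trans (·-cong g x≈0 k) (·-0v g k))

  MapsOnto-functional : ∀ {i j j′} → MapsOnto g i j → MapsOnto g i j′ → j ≡ j′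
  MapsOnto-functional {i} {j} {j′} (into , _) (into′ , _) with j ≟ j′
  ... | yes j≡j′ = j≡j′
  ... | no j≢j′  = ⊥-elim (unit≉0v (blockFst i) (Equivalence.to ·-≈0v⇔ ge≈0))
    where
    e∈V = unit-blockFst-∈V i
    ge≈0 = ∈V-disjoint j≢j′ (into _ e∈V) (into′ _ e∈V)

  MapsOnto-injective : ∀ {i i′ j} → MapsOnto g i j → MapsOnto g i′ j → i ≡ i′
  MapsOnto-injective {i} {i′} {j} (_ , onto) (_ , onto′)
    with i ≟ i′ | onto _ (unit-blockFst-∈V j) | onto′ _ (unit-blockFst-∈V j)
  ... | yes i≡i′ | _ | _ = i≡i′
  ... | no i≢i′  | z , z∈Vi , gz≈e | z′ , z′∈Vi′ , gz′≈e = ⊥-elim (unit≉0v (blockFst j) e≈0)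
    where
    z≈0 : z ≈ᵛ 0v
    z≈0 = ∈V-disjoint i≢i′ z∈Vi (∈V-resp-≈ (g-injective λ k → trans (gz′≈e k) (sym (gz≈e k))) z′∈Vi′)
    e≈0 : unit (blockFst j) ≈ᵛ 0v
    e≈0 k = trans (sym (gz≈e k)) (Equivalence.from ·-≈0v⇔ z≈0 k)

  MapsOnto-blockNonzero : ∀ {i j y} → MapsOnto g i j → y ∈V i →
                          blockNonzero (g · y) j ≡ blockNonzero y i
  MapsOnto-blockNonzero (into , _) y∈V = ≡false-ext
    (⇔.trans (blockNonzero≡false⇔ (into _ y∈V)) (⇔.trans ·-≈0v⇔ (⇔.sym (blockNonzero≡false⇔ y∈V))))

  module TetradPermutation (stab : StabilizesTetrad g) where

    σ σ⁻¹ : Fin 4 → Fin 4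
    σ   i = proj₁ (proj₁ stab i)
    σ⁻¹ j = proj₁ (proj₂ stab j)

    σ-mapsOnto : ∀ i → MapsOnto g i (σ i)
    σ-mapsOnto i = proj₂ (proj₁ stab i)

    σ⁻¹-mapsOnto : ∀ j → MapsOnto g (σ⁻¹ j) j
    σ⁻¹-mapsOnto j = proj₂ (proj₂ stab j)

    σ-injective : ∀ {i i′} → σ i ≡ σ i′ → i ≡ i′
    σ-injective {i} {i′} σi≡σi′ =
      MapsOnto-injective (σ-mapsOnto i) (subst (MapsOnto g i′) (sym σi≡σi′) (σ-mapsOnto i′))

    π : Permutation′ 4
    π = permutation σ σ⁻¹
      (λ j → sym (MapsOnto-functional (σ⁻¹-mapsOnto j) (σ-mapsOnto (σ⁻¹ j))))
      (λ i → sym (MapsOnto-injective (σ-mapsOnto i) (σ⁻¹-mapsOnto (σ i))))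

    entry-vanishes : ∀ {k m} → blockOf k ≢ σ (blockOf m) → g k m ≡ false
    entry-vanishes {k} {m} k∉σm =
      trans (sym (·-unit g k m)) (∈V-outside (proj₁ (σ-mapsOnto (blockOf m)) (unit m) (unit-∈V m)) k∉σm)

    ·-restrict : ∀ x i {k} → blockOf k ≡ σ i → (g · x) k ≡ (g · restrict x i) k
    ·-restrict x i {k} k∈σi = Σ₂-cong entry
      where
      entry : ∀ m → g k m ∧ x m ≡ g k m ∧ restrict x i m
      entry m with blockOf m ≟ i
      ... | yes _  = refl
      ... | no m∉i rewrite entry-vanishes {k} {m} λ k∈σm → m∉i (σ-injective (trans (sym k∈σm) k∈σi)) = refl

    blockNonzero-σ : ∀ x i → blockNonzero (g · x) (σ i) ≡ blockNonzero x i
    blockNonzero-σ x i = begin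
      blockNonzero (g · x) (σ i)             ≡⟨ cong₂ _∨_ (·-restrict x i (blockOf-blockFst (σ i)))
                                                          (·-restrict x i (blockOf-blockSnd (σ i))) ⟩
      blockNonzero (g · restrict x i) (σ i)  ≡⟨ MapsOnto-blockNonzero (σ-mapsOnto i) (restrict-∈V x i) ⟩
      blockNonzero (restrict x i) i          ≡⟨ blockNonzero-restrict x i ⟩
      blockNonzero x i                       ∎
      where open ≡-Reasoning

corollary1 : (g : Mat₈) → In𝒢L₄ g → (x : V₈) → Q (g · x) ≡ Q x
corollary1 g (g∈GL , stab) x = begin
  Q (g · x)                           ≡⟨ Q≡Σ₂-blockNonzero (g · x) ⟩
  Σ₂ (blockNonzero (g · x))           ≡⟨ Σ₂-permute (blockNonzero (g · x)) π ⟩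
  Σ₂ (λ i → blockNonzero (g · x) (σ i)) ≡⟨ Σ₂-cong (blockNonzero-σ x) ⟩
  Σ₂ (blockNonzero x)                 ≡⟨ Q≡Σ₂-blockNonzero x ⟨
  Q x                                 ∎
  where
  open ≡-Reasoning
  open TetradPermutation g (IsGL⇒injective g g∈GL) stab
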